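{- If $X=(x^1,\dots,x^k)$ and $Y=(y^1,\dots,y^k)$ form a $k$-pattern of $\{0,1\}^n$, then $X$ and $Y$ are antichains (for the componentwise order) and $k\le n$.
   Context: A $k$-pattern of $P\subseteq\{0,1\}^n$ is a pair of sequences $(x^1,\dots,x^k)$, $(y^1,\dots,y^k)$, each consisting of $k$ distinct elements of $P$, such that for all $p,q\in[k]$: $x^p\le y^q$ iff $p\neq q$ (componentwise order). -}

module Defs where

open import Data.Nat using (ℕ)
open import Data.Bool using (Bool)
open import Data.Bool renaming (_≤_ to _≤ᵇ_)
open import Data.Fin using (Fin)
open import Data.Vec using (Vec; lookup)
open import Relation.Binary.PropositionalEquality using (_≡_; _≢_)
open import Function.Bundles using (_⇔_)

Cube : ℕ → Set
Cube n = Vec Bool n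

_≤c_ : {n : ℕ} → Cube n → Cube n → Set
_≤c_ {n} x y = (i : Fin n) → lookup x i ≤ᵇ lookup y i

Distinct : {n k : ℕ} → (Fin k → Cube n) → Set
Distinct {k = k} x = (p q : Fin k) → x p ≡ x q → p ≡ q

-- k-pattern of {0,1}^n (P = whole cube)
IsPattern : {n k : ℕ} → (Fin k → Cube n) → (Fin k → Cube n) → Set
IsPattern {k = k} x y =
  Distinct x × Distinct y × ((p q : Fin k) → (x p ≤c y q) ⇔ (p ≢ q))
  where open import Data.Product using (_×_)

Antichain : {n k : ℕ} → (Fin k → Cube n) → Set
Antichain {k = k} x = (p q : Fin k) → p ≢ q → ¬ (x p ≤c x q)
  where open import Relation.Nullary using (¬_)

-- Every x^p lies below y^q for q ≠ p, so x^p ≤ x^q would force x^p ≤ y^p, which the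
-- pattern forbids; dually for y. Since x^p ≰ y^p, some coordinate i(p) has x^p = 1 and
-- y^p = 0 there. If i(p) = i(q) with p ≠ q then x^p ≤ y^q fails at that coordinate, so
-- p ↦ i(p) is an injection [k] → [n] and k ≤ n.
module Submission where

open import Defs
open import Data.Nat using (ℕ; _≤_)
open import Data.Fin using (Fin; _≟_)
open import Data.Fin.Properties using (¬∀⟶∃¬; injective⇒≤)
open import Data.Product using (_×_; _,_; proj₁; proj₂; ∃-syntax)
open import Data.Bool using (Bool; true; false)
open import Data.Bool.Base using (b≤b) renaming (_≤_ to _≤ᵇ_)
import Data.Bool.Properties as Bool
open import Data.Vec using (lookup)
open import Data.Empty using (⊥-elim)
open import Function.Bundles using (Equivalence; _⇔_)
open import Function.Definitions using (Injective)
open import Relation.Binary.PropositionalEquality using (_≡_; _≢_; refl; ≢-sym; subst; subst₂)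
open import Relation.Nullary using (¬_; yes; no)

≰ᵇ⇒true-false : ∀ {a b : Bool} → ¬ (a ≤ᵇ b) → a ≡ true × b ≡ false
≰ᵇ⇒true-false {false} {b}     a≰b = ⊥-elim (a≰b (Bool.≤-minimum b))
≰ᵇ⇒true-false {true}  {false} a≰b = refl , refl
≰ᵇ⇒true-false {true}  {true}  a≰b = ⊥-elim (a≰b b≤b)

≤c-trans : ∀ {n} {x y z : Cube n} → x ≤c y → y ≤c z → x ≤c z
≤c-trans x≤y y≤z i = Bool.≤-trans (x≤y i) (y≤z i)

≰c⇒separating : ∀ {n} {x y : Cube n} → ¬ (x ≤c y) →
                ∃[ i ] (lookup x i ≡ true × lookup y i ≡ false)
≰c⇒separating {n} {x} {y} x≰y =
  let i , xᵢ≰yᵢ = ¬∀⟶∃¬ n _ (λ i → lookup x i Bool.≤? lookup y i) x≰y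
  in i , ≰ᵇ⇒true-false xᵢ≰yᵢ

module Pattern {n k : ℕ} {x y : Fin k → Cube n} (isPattern : IsPattern x y) where

  private
    crossing : ∀ p q → x p ≤c y q ⇔ p ≢ q
    crossing = proj₂ (proj₂ isPattern)

  x≤y : ∀ {p q} → p ≢ q → x p ≤c y q
  x≤y {p} {q} = Equivalence.from (crossing p q)

  x≰y : ∀ p → ¬ (x p ≤c y p)
  x≰y p xp≤yp = Equivalence.to (crossing p p) xp≤yp refl

  antichain-x : Antichain x
  antichain-x p q p≢q xp≤xq = x≰y p (≤c-trans {x = x p} {x q} {y p} xp≤xq (x≤y (≢-sym p≢q)))

  antichain-y : Antichain y
  antichain-y p q p≢q yp≤yq = x≰y q (≤c-trans {x = x q} {y p} {y q} (x≤y (≢-sym p≢q)) yp≤yq)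

  separating : ∀ p → ∃[ i ] (lookup (x p) i ≡ true × lookup (y p) i ≡ false)
  separating p = ≰c⇒separating {x = x p} {y = y p} (x≰y p)

  separator : Fin k → Fin n
  separator p = proj₁ (separating p)

  separator-injective : Injective _≡_ _≡_ separator
  separator-injective {p} {q} same with p ≟ q
  ... | yes p≡q = p≡q
  ... | no p≢q = ⊥-elim (true≰false (subst₂ _≤ᵇ_ xp≡true yq≡false (x≤y p≢q (separator q))))
    where
    true≰false : ¬ (true ≤ᵇ false)
    true≰false ()
    xp≡true : lookup (x p) (separator q) ≡ true
    xp≡true = subst (λ i → lookup (x p) i ≡ true) same (proj₁ (proj₂ (separating p)))
    yq≡false : lookup (y q) (separator q) ≡ false
    yq≡false = proj₂ (proj₂ (separating q))

proposition1 : (n k : ℕ) (x y : Fin k → Cube n) →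
    IsPattern x y → Antichain x × Antichain y × k ≤ n
proposition1 n k x y isPattern =
  antichain-x , antichain-y , injective⇒≤ separator-injective
  where open Pattern isPattern
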